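{- Let $P=(X,\prec)$ be a finite twin-free interval order with no induced subposet isomorphic to any of $\mathbf{4}+\mathbf{1}$, $\mathbf{3}+\mathbf{1}+\mathbf{1}$, $Z$, $D$, $Y$, or the dual of $Y$. Then there exists a closed interval representation $\{I(x):x\in X\}$ of $P$ satisfying: (1) no interval strictly contains two other intervals (i.e., there are no distinct $u,v,w$ with $I(u),I(v)$ both strictly contained in $I(w)$); (2) no interval is strictly contained in two other intervals; (3) if $I(u)\subsetneq I(v)$, then there are unique $x,y\in X$ such that $x$ peeks into $vu$ from the left and $y$ peeks into $vu$ from the right.
   Context: Posets are strict partial orders on a finite set; induced subposet means restriction to a subset, up to isomorphism. A closed interval representation assigns to each $x$ a closed interval $I(x)=[L(x),R(x)]$ with $x\prec y$ iff $R(x)<L(y)$; an interval order is a poset having one. $I(u)$ is strictly contained in $I(v)$ if $I(u)\subset I(v)$ and they do not have identical endpoints. Twins are elements with exactly the same comparabilities; twin-free means none. For $I(u)\subset I(v)$, $x$ peeks into $vu$ if $I(x)$ meets $I(v)$ but not $I(u)$; from the left if also $R(x)\le L(u)$, from the right if also $R(u)\le L(x)$. The posets (listed comparabilities plus transitive consequences, other pairs incomparable): $\mathbf{4}+\mathbf{1}$ on $\{a,b,c,d,x\}$ with $a\prec b\prec c\prec d$; $\mathbf{3}+\mathbf{1}+\mathbf{1}$ on $\{a,b,c,x,y\}$ with $a\prec b\prec c$; $Z$ on $\{a,b,c,d,x,y\}$ with $a\prec b\prec c\prec d$, $x\prec d$, $a\prec y$; $D$ on $\{a,b,c,d,x\}$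 with $a\prec b\prec d$, $a\prec c\prec d$; $Y$ on $\{a,b,c,d,x\}$ with $a\prec d\prec b$, $a\prec d\prec c$; the dual reverses all comparabilities. -}

module Defs where

open import Data.Nat using (ℕ; _≤_; _<_; _≡ᵇ_)
open import Data.Fin using (Fin; toℕ)
open import Data.Bool using (Bool; T; _∧_)
open import Data.List using (List; []; _∷_)
open import Data.Bool.ListAction using (any)
open import Data.Product using (Σ; ∃; _×_; _,_)
open import Data.Sum using (_⊎_)
open import Relation.Binary.PropositionalEquality using (_≡_; _≢_)
open import Relation.Nullary using (¬_)
open import Function using (flip)
open import Function.Bundles using (_⇔_)
open import Function.Definitions using (Injective)

record FinPoset (n : ℕ) : Set where
  field
    rel     : Fin n → Fin n → Bool
    irrefl  : ∀ x → ¬ T (rel x x)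
    trans   : ∀ x y z → T (rel x y) → T (rel y z) → T (rel x z)

open FinPoset public

_≺[_]_ : ∀ {n} → Fin n → FinPoset n → Fin n → Set
x ≺[ P ] y = T (rel P x y)

Twins : ∀ {n} → FinPoset n → Fin n → Fin n → Set
Twins P x y = ∀ z → ((z ≺[ P ] x) ⇔ (z ≺[ P ] y)) × ((x ≺[ P ] z) ⇔ (y ≺[ P ] z))

TwinFree : ∀ {n} → FinPoset n → Set
TwinFree P = ∀ x y → Twins P x y → x ≡ y

record IntervalRep {n : ℕ} (P : FinPoset n) : Set where
  field
    L R    : Fin n → ℕ
    L≤R    : ∀ x → L x ≤ R x
    repr   : ∀ x y → (x ≺[ P ] y) ⇔ (R x < L y)

open IntervalRep public

IsIntervalOrder : ∀ {n} → FinPoset n → Set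
IsIntervalOrder P = IntervalRep P

module _ {n : ℕ} {P : FinPoset n} (I : IntervalRep P) where

  Contained : Fin n → Fin n → Set
  Contained u v = (L I v ≤ L I u) × (R I u ≤ R I v)

  StrictlyContained : Fin n → Fin n → Set
  StrictlyContained u v = Contained u v × ¬ ((L I u ≡ L I v) × (R I u ≡ R I v))

  Meets : Fin n → Fin n → Set
  Meets x y = (L I x ≤ R I y) × (L I y ≤ R I x)

  PeeksInto : Fin n → Fin n → Fin n → Set
  PeeksInto x v u = Meets x v × ¬ Meets x u

  PeeksLeft : Fin n → Fin n → Fin n → Set
  PeeksLeft x v u = PeeksInto x v u × (R I x ≤ L I u)

  PeeksRight : Fin n → Fin n → Fin n → Set
  PeeksRight x v u = PeeksInto x v u × (R I u ≤ L I x)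

∃! : ∀ {n} → (Fin n → Set) → Set
∃! {n} Q = Σ (Fin n) λ x → Q x × (∀ y → Q y → y ≡ x)


-- Small posets given by their full list of comparable pairs (transitively closed).
pairRel : ∀ {m} → List (ℕ × ℕ) → Fin m → Fin m → Bool
pairRel ps x y = any (λ { (i , j) → (toℕ x ≡ᵇ i) ∧ (toℕ y ≡ᵇ j) }) ps

-- 4+1 : a=0 ≺ b=1 ≺ c=2 ≺ d=3, x=4
rel-4+1 : Fin 5 → Fin 5 → Bool
rel-4+1 = pairRel ((0 , 1) ∷ (0 , 2) ∷ (0 , 3) ∷ (1 , 2) ∷ (1 , 3) ∷ (2 , 3) ∷ [])

-- 3+1+1 : a=0 ≺ b=1 ≺ c=2, x=3, y=4
rel-3+1+1 : Fin 5 → Fin 5 → Bool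
rel-3+1+1 = pairRel ((0 , 1) ∷ (0 , 2) ∷ (1 , 2) ∷ [])

-- Z : a=0 ≺ b=1 ≺ c=2 ≺ d=3, x=4 ≺ d, a ≺ y=5
rel-Z : Fin 6 → Fin 6 → Bool
rel-Z = pairRel ((0 , 1) ∷ (0 , 2) ∷ (0 , 3) ∷ (1 , 2) ∷ (1 , 3) ∷ (2 , 3)
                 ∷ (4 , 3) ∷ (0 , 5) ∷ [])

-- D : a=0 ≺ b=1 ≺ d=3, a ≺ c=2 ≺ d, x=4
rel-D : Fin 5 → Fin 5 → Bool
rel-D = pairRel ((0 , 1) ∷ (0 , 2) ∷ (0 , 3) ∷ (1 , 3) ∷ (2 , 3) ∷ [])

-- Y : a=0 ≺ d=3 ≺ b=1, a ≺ d ≺ c=2, x=4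
rel-Y : Fin 5 → Fin 5 → Bool
rel-Y = pairRel ((0 , 3) ∷ (0 , 1) ∷ (0 , 2) ∷ (3 , 1) ∷ (3 , 2) ∷ [])

rel-Yᵈ : Fin 5 → Fin 5 → Bool
rel-Yᵈ = flip rel-Y

-- The forbidden configurations, as bare (transitively closed) relations; "P contains an induced copy"
-- is stated directly on the relation (these are strict orders, but we avoid
-- needing to package their proofs).
HasInducedRel : ∀ {m n} → FinPoset n → (Fin m → Fin m → Bool) → Set
HasInducedRel {m} {n} P q =
  Σ (Fin m → Fin n) λ f → Injective _≡_ _≡_ f × (∀ a b → T (q a b) ⇔ (f a ≺[ P ] f b))

Forbidden : ∀ {n} → FinPoset n → Set
Forbidden P = ¬ HasInducedRel P rel-4+1 × ¬ HasInducedRel P rel-3+1+1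
            × ¬ HasInducedRel P rel-Z × ¬ HasInducedRel P rel-D
            × ¬ HasInducedRel P rel-Y × ¬ HasInducedRel P rel-Yᵈ

-- Interval orders are crossing-free (2+2-free), so the
-- sets D(x) of predecessors and U(x) of successors form chains and sizes compare them.  Call
-- u nested in v when D(v) ⊊ D(u) and U(v) ⊊ U(u).  Without 4+1 and Y a nested pair has at
-- most one right peeker (above u, not above v); in the dual order this says: without 4+1 and
-- Y-dual at most one left peeker.  With crossing-freeness, uniqueness of peekers makes two
-- elements nested in a common one, or containing a common nested one, twins.  Finally the
-- canonical representation I(x) = [⟨2|D(x)|+1, 2|S(x)|⟩, ⟨2|S(x)|, 2|D(x)|+1⟩] (lexicographic
-- pairs, S(x) = elements whose successor set contains U(x)) turns strict containment into
-- nestedness and peeking into peekers.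
module Submission where

open import Defs
open import Data.Nat using (ℕ)
open import Data.Fin using (Fin)
open import Data.Product using (Σ; _×_)
open import Relation.Binary.PropositionalEquality using (_≢_)
open import Relation.Nullary using (¬_)

open import Data.Nat using (suc; _≤_; _<_; _*_; _+_; _≤ᵇ_; s≤s)
open import Data.Nat.Properties
  using ( ≤-refl; ≤-trans; ≤-antisym; ≤-total; ≤-<-trans; <⇒≤; <⇒≱; ≮⇒≥; ≰⇒>; ≤∧≢⇒<; ≤-pred
        ; m≤n⇒m≤1+n; ≤ᵇ⇒≤; ≤⇒≤ᵇ; +-comm; +-monoʳ-<; +-cancelˡ-≤; *-monoˡ-≤; *-monoʳ-≤; *-cancelˡ-<
        ; *-suc; m≤m+n; module ≤-Reasoning )
open import Data.Fin using (zero; suc) renaming (_≟_ to _≟ᶠ_)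
open import Data.Fin.Properties using (any?; all?)
open import Data.Fin.Subset using (_∈_; _⊆_; ∣_∣)
open import Data.Fin.Subset.Properties using (p⊆q⇒∣p∣≤∣q∣; p⊂q⇒∣p∣<∣q∣; ∣p∣≤n)
open import Data.Vec using ([]; _∷_; tabulate; lookup)
open import Data.Vec.Properties using ([]=⇒lookup; lookup⇒[]=; lookup∘tabulate)
open import Data.Bool using (Bool; true; false; T)
open import Data.Bool.Properties using (T?; T-≡) renaming (_≟_ to _≟ᵇ_)
open import Data.Product using (_,_; proj₁; proj₂; swap)
open import Data.Sum using (_⊎_; inj₁; inj₂; [_,_])
open import Data.Empty using (⊥; ⊥-elim)
open import Data.Unit using (tt)
open import Relation.Nullary using (yes; no)
open import Relation.Nullary.Decidable
  using (Dec; ¬?; _×-dec_; _⊎-dec_; _→-dec_; decidable-stable; from-yes)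
open import Relation.Binary.PropositionalEquality
  using (_≡_; refl; sym; cong; cong₂; subst; subst₂) renaming (trans to ≡-trans)
open import Function using (flip)
open import Function.Bundles using (Equivalence; mk⇔)
open import Function.Definitions using (Injective)

open Equivalence using (to; from)

#_ : ∀ {n} → (Fin n → Bool) → ℕ
# p = ∣ tabulate p ∣

∈-tabulate⁻ : ∀ {n} {p : Fin n → Bool} {a} → a ∈ tabulate p → T (p a)
∈-tabulate⁻ {p = p} {a} a∈p = from T-≡ (≡-trans (sym (lookup∘tabulate p a)) ([]=⇒lookup a∈p))

∈-tabulate⁺ : ∀ {n} {p : Fin n → Bool} {a} → T (p a) → a ∈ tabulate p
∈-tabulate⁺ {p = p} {a} pa = lookup⇒[]= a (tabulate p) (≡-trans (lookup∘tabulate p a) (to T-≡ pa))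

#-bound : ∀ {n} (p : Fin n → Bool) → # p ≤ n
#-bound p = ∣p∣≤n (tabulate p)

tabulate-⊆ : ∀ {n} {p q : Fin n → Bool} → (∀ a → T (p a) → T (q a)) → tabulate p ⊆ tabulate q
tabulate-⊆ p⇒q a∈p = ∈-tabulate⁺ (p⇒q _ (∈-tabulate⁻ a∈p))

#-mono : ∀ {n} {p q : Fin n → Bool} → (∀ a → T (p a) → T (q a)) → # p ≤ # q
#-mono {p = p} {q} p⇒q = p⊆q⇒∣p∣≤∣q∣ {p = tabulate p} {tabulate q} (tabulate-⊆ p⇒q)

#-strict : ∀ {n} {p q : Fin n → Bool} →
  (∀ a → T (p a) → T (q a)) → ∀ a → T (q a) → ¬ T (p a) → # p < # q
#-strict {p = p} {q} p⇒q a qa ¬pa = p⊂q⇒∣p∣<∣q∣ {p = tabulate p} {tabulate q}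
  (tabulate-⊆ p⇒q , a , ∈-tabulate⁺ qa , λ a∈p → ¬pa (∈-tabulate⁻ a∈p))

#-witness : ∀ {n} {p q : Fin n → Bool} → # p < # q → Σ (Fin n) λ a → T (q a) × ¬ T (p a)
#-witness {p = p} {q = q} p<q with any? (λ a → T? (q a) ×-dec ¬? (T? (p a)))
... | yes witness = witness
... | no none = ⊥-elim (<⇒≱ p<q (#-mono λ a qa →
                  decidable-stable (T? (p a)) λ ¬pa → none (a , qa , ¬pa)))

-- The dual order: all comparabilities reversed.  Dualising twice gives back P definitionally.
_ᵈ : ∀ {n} → FinPoset n → FinPoset n
P ᵈ = record
  { rel    = flip (rel P)
  ; irrefl = irrefl P
  ; trans  = λ x y z y≺x z≺y → trans P z y x z≺y y≺x
  }

_∥[_]_ : ∀ {n} → Fin n → FinPoset n → Fin n → Set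
a ∥[ P ] b = ¬ a ≺[ P ] b × ¬ b ≺[ P ] a

-- No induced 2+2: the order-theoretic shadow of having an interval representation.
CrossingFree : ∀ {n} → FinPoset n → Set
CrossingFree P = ∀ {a x b y} → a ≺[ P ] x → b ≺[ P ] y → a ≺[ P ] y ⊎ b ≺[ P ] x

FourPlusOneFree : ∀ {n} → FinPoset n → Set
FourPlusOneFree P = ∀ {c₀ c₁ c₂ c₃ x} →
  c₀ ≺[ P ] c₁ → c₁ ≺[ P ] c₂ → c₂ ≺[ P ] c₃ →
  x ∥[ P ] c₀ → x ∥[ P ] c₁ → x ∥[ P ] c₂ → x ∥[ P ] c₃ → ⊥

YFree : ∀ {n} → FinPoset n → Set
YFree P = ∀ {a b c d x} →
  a ≺[ P ] d → d ≺[ P ] b → d ≺[ P ] c → b ∥[ P ] c → b ≢ c →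
  x ∥[ P ] a → x ∥[ P ] b → x ∥[ P ] c → x ∥[ P ] d → ⊥

crossingFree-dual : ∀ {n} {P : FinPoset n} → CrossingFree P → CrossingFree (P ᵈ)
crossingFree-dual crossingFree x≺a y≺b = crossingFree y≺b x≺a

-- The dual of 4+1 is again 4+1, read along the reversed chain.
fourPlusOneFree-dual : ∀ {n} {P : FinPoset n} → FourPlusOneFree P → FourPlusOneFree (P ᵈ)
fourPlusOneFree-dual no41 c₁≺c₀ c₂≺c₁ c₃≺c₂ x∥c₀ x∥c₁ x∥c₂ x∥c₃ =
  no41 c₃≺c₂ c₂≺c₁ c₁≺c₀ (swap x∥c₃) (swap x∥c₂) (swap x∥c₁) (swap x∥c₀)

-- Interval orders are crossing-free: whichever of a, b has the earlier right end precedes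
-- both x and y.
rep-crossingFree : ∀ {n} {P : FinPoset n} → IntervalRep P → CrossingFree P
rep-crossingFree {P = P} I {a} {x} {b} {y} a≺x b≺y with ≤-total (R I a) (R I b)
... | inj₁ Ra≤Rb = inj₁ (from (repr I a y) (≤-<-trans Ra≤Rb (to (repr I b y) b≺y)))
... | inj₂ Rb≤Ra = inj₂ (from (repr I b x) (≤-<-trans Rb≤Ra (to (repr I a x) a≺x)))

pattern p₀ = zero
pattern p₁ = suc zero
pattern p₂ = suc (suc zero)
pattern p₃ = suc (suc (suc zero))
pattern p₄ = suc (suc (suc (suc zero)))

PatternTwins : ∀ {m} → (Fin m → Fin m → Bool) → Fin m → Fin m → Set
PatternTwins q a b = ∀ c → q a c ≡ q b c × q c a ≡ q c b

patternTwins? : ∀ {m} (q : Fin m → Fin m → Bool) a b → Dec (PatternTwins q a b)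
patternTwins? q a b = all? λ c → (q a c ≟ᵇ q b c) ×-dec (q c a ≟ᵇ q c b)

4+1-twinFree : ∀ a b → PatternTwins rel-4+1 a b → a ≡ b
4+1-twinFree = from-yes (all? λ a → all? λ b → patternTwins? rel-4+1 a b →-dec (a ≟ᶠ b))

Y-twins : ∀ a b → PatternTwins rel-Y a b → a ≡ b ⊎ (a ≡ p₁ × b ≡ p₂) ⊎ (a ≡ p₂ × b ≡ p₁)
Y-twins = from-yes (all? λ a → all? λ b → patternTwins? rel-Y a b →-dec
            ((a ≟ᶠ b) ⊎-dec ((a ≟ᶠ p₁) ×-dec (b ≟ᶠ p₂)) ⊎-dec ((a ≟ᶠ p₂) ×-dec (b ≟ᶠ p₁))))

module _ {n m} (P : FinPoset n) {q : Fin m → Fin m → Bool} (f : Fin m → Fin n)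
         (table : ∀ a b → rel P (f a) (f b) ≡ q a b) where

  identified-twins : ∀ {a b} → f a ≡ f b → PatternTwins q a b
  identified-twins {a} {b} fa≡fb c =
    ≡-trans (sym (table a c)) (≡-trans (cong (λ z → rel P z (f c)) fa≡fb) (table b c)) ,
    ≡-trans (sym (table c a)) (≡-trans (cong (rel P (f c)) fa≡fb) (table c b))

  induced : Injective _≡_ _≡_ f → HasInducedRel P q
  induced f-injective =
    f , f-injective , λ a b → mk⇔ (subst T (sym (table a b))) (subst T (table a b))

holds : ∀ {n} (P : FinPoset n) {a b} → a ≺[ P ] b → rel P a b ≡ true
holds P = to T-≡

fails : ∀ {n} (P : FinPoset n) {a b} → ¬ a ≺[ P ] b → rel P a b ≡ false
fails P {a} {b} a⊀b with rel P a b
... | true  = ⊥-elim (a⊀b tt)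
... | false = refl

irreflexive : ∀ {n} (P : FinPoset n) a → rel P a a ≡ false
irreflexive P a = fails P (irrefl P a)

asymmetric : ∀ {n} (P : FinPoset n) {a b} → a ≺[ P ] b → rel P b a ≡ false
asymmetric P {a} {b} a≺b = fails P λ b≺a → irrefl P a (trans P a b a a≺b b≺a)

¬4+1⇒fourPlusOneFree : ∀ {n} {P : FinPoset n} → ¬ HasInducedRel P rel-4+1 → FourPlusOneFree P
¬4+1⇒fourPlusOneFree {P = P} ¬4+1 {c₀} {c₁} {c₂} {c₃} {x} c₀≺c₁ c₁≺c₂ c₂≺c₃
  (x⊀c₀ , c₀⊀x) (x⊀c₁ , c₁⊀x) (x⊀c₂ , c₂⊀x) (x⊀c₃ , c₃⊀x) =
  ¬4+1 (induced P f table f-injective)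
  where
  f : Fin 5 → Fin _
  f = lookup (c₀ ∷ c₁ ∷ c₂ ∷ c₃ ∷ x ∷ [])
  c₀≺c₂ : c₀ ≺[ P ] c₂
  c₀≺c₂ = trans P c₀ c₁ c₂ c₀≺c₁ c₁≺c₂
  c₁≺c₃ : c₁ ≺[ P ] c₃
  c₁≺c₃ = trans P c₁ c₂ c₃ c₁≺c₂ c₂≺c₃
  c₀≺c₃ : c₀ ≺[ P ] c₃
  c₀≺c₃ = trans P c₀ c₂ c₃ c₀≺c₂ c₂≺c₃
  table : ∀ a b → rel P (f a) (f b) ≡ rel-4+1 a b
  table p₀ p₀ = irreflexive P c₀
  table p₀ p₁ = holds P c₀≺c₁
  table p₀ p₂ = holds P c₀≺c₂
  table p₀ p₃ = holds P c₀≺c₃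
  table p₀ p₄ = fails P c₀⊀x
  table p₁ p₀ = asymmetric P c₀≺c₁
  table p₁ p₁ = irreflexive P c₁
  table p₁ p₂ = holds P c₁≺c₂
  table p₁ p₃ = holds P c₁≺c₃
  table p₁ p₄ = fails P c₁⊀x
  table p₂ p₀ = asymmetric P c₀≺c₂
  table p₂ p₁ = asymmetric P c₁≺c₂
  table p₂ p₂ = irreflexive P c₂
  table p₂ p₃ = holds P c₂≺c₃
  table p₂ p₄ = fails P c₂⊀x
  table p₃ p₀ = asymmetric P c₀≺c₃
  table p₃ p₁ = asymmetric P c₁≺c₃
  table p₃ p₂ = asymmetric P c₂≺c₃
  table p₃ p₃ = irreflexive P c₃
  table p₃ p₄ = fails P c₃⊀x
  table p₄ p₀ = fails P x⊀c₀
  table p₄ p₁ = fails P x⊀c₁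
  table p₄ p₂ = fails P x⊀c₂
  table p₄ p₃ = fails P x⊀c₃
  table p₄ p₄ = irreflexive P x
  -- f can only identify pattern twins, and 4+1 has none.
  f-injective : Injective _≡_ _≡_ f
  f-injective {i} {j} fi≡fj = 4+1-twinFree i j (identified-twins P f table {i} {j} fi≡fj)

¬Y⇒yFree : ∀ {n} {P : FinPoset n} → ¬ HasInducedRel P rel-Y → YFree P
¬Y⇒yFree {P = P} ¬Y {a} {b} {c} {d} {x} a≺d d≺b d≺c (b⊀c , c⊀b) b≢c
  (x⊀a , a⊀x) (x⊀b , b⊀x) (x⊀c , c⊀x) (x⊀d , d⊀x) =
  ¬Y (induced P f table f-injective)
  where
  f : Fin 5 → Fin _
  f = lookup (a ∷ b ∷ c ∷ d ∷ x ∷ [])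
  a≺b : a ≺[ P ] b
  a≺b = trans P a d b a≺d d≺b
  a≺c : a ≺[ P ] c
  a≺c = trans P a d c a≺d d≺c
  table : ∀ i j → rel P (f i) (f j) ≡ rel-Y i j
  table p₀ p₀ = irreflexive P a
  table p₀ p₁ = holds P a≺b
  table p₀ p₂ = holds P a≺c
  table p₀ p₃ = holds P a≺d
  table p₀ p₄ = fails P a⊀x
  table p₁ p₀ = asymmetric P a≺b
  table p₁ p₁ = irreflexive P b
  table p₁ p₂ = fails P b⊀c
  table p₁ p₃ = asymmetric P d≺b
  table p₁ p₄ = fails P b⊀x
  table p₂ p₀ = asymmetric P a≺c
  table p₂ p₁ = fails P c⊀b
  table p₂ p₂ = irreflexive P c
  table p₂ p₃ = asymmetric P d≺c
  table p₂ p₄ = fails P c⊀x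
  table p₃ p₀ = asymmetric P a≺d
  table p₃ p₁ = holds P d≺b
  table p₃ p₂ = holds P d≺c
  table p₃ p₃ = irreflexive P d
  table p₃ p₄ = fails P d⊀x
  table p₄ p₀ = fails P x⊀a
  table p₄ p₁ = fails P x⊀b
  table p₄ p₂ = fails P x⊀c
  table p₄ p₃ = fails P x⊀d
  table p₄ p₄ = irreflexive P x
  -- f can only identify pattern twins, and the twins b, c are distinct by hypothesis.
  f-injective : Injective _≡_ _≡_ f
  f-injective {i} {j} fi≡fj =
    [ (λ i≡j → i≡j) ,
      [ (λ { (i≡p₁ , j≡p₂) → ⊥-elim (b≢c (subst₂ (λ k l → f k ≡ f l) i≡p₁ j≡p₂ fi≡fj)) }) ,
        (λ { (i≡p₂ , j≡p₁) → ⊥-elim (b≢c (sym (subst₂ (λ k l → f k ≡ f l) i≡p₂ j≡p₁ fi≡fj))) }) ] ]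
    (Y-twins i j (identified-twins P f table {i} {j} fi≡fj))

induced-dual : ∀ {n m} {P : FinPoset n} {q : Fin m → Fin m → Bool} →
               HasInducedRel (P ᵈ) q → HasInducedRel P (flip q)
induced-dual (f , f-injective , f-induces) = f , f-injective , λ a b → f-induces b a

¬Yᵈ⇒yDualFree : ∀ {n} {P : FinPoset n} → ¬ HasInducedRel P rel-Yᵈ → YFree (P ᵈ)
¬Yᵈ⇒yDualFree {P = P} ¬Yᵈ = ¬Y⇒yFree {P = P ᵈ} (λ Y → ¬Yᵈ (induced-dual {P = P} Y))

record Admissible {n} (P : FinPoset n) : Set where
  field
    crossingFree    : CrossingFree P
    fourPlusOneFree : FourPlusOneFree P
    yFree           : YFree P
    yDualFree       : YFree (P ᵈ)

open Admissible

admissible : ∀ {n} {P : FinPoset n} → IntervalRep P → Forbidden P → Admissible P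
admissible {P = P} I (¬4+1 , _ , _ , _ , ¬Y , ¬Yᵈ) = record
  { crossingFree    = rep-crossingFree I
  ; fourPlusOneFree = ¬4+1⇒fourPlusOneFree {P = P} ¬4+1
  ; yFree           = ¬Y⇒yFree {P = P} ¬Y
  ; yDualFree       = ¬Yᵈ⇒yDualFree {P = P} ¬Yᵈ
  }

admissible-dual : ∀ {n} {P : FinPoset n} → Admissible P → Admissible (P ᵈ)
admissible-dual {P = P} A = record
  { crossingFree    = crossingFree-dual {P = P} (crossingFree A)
  ; fourPlusOneFree = fourPlusOneFree-dual {P = P} (fourPlusOneFree A)
  ; yFree           = yDualFree A
  ; yDualFree       = yFree A
  }

-- x is a left peeker of the pair (v , u): below u but not below v.  Read in the dual order,
-- a left peeker is a right peeker: above u but not above v.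
LeftPeeker RightPeeker : ∀ {n} → FinPoset n → Fin n → Fin n → Fin n → Set
LeftPeeker  P v u x = x ≺[ P ] u × ¬ x ≺[ P ] v
RightPeeker P v u y = LeftPeeker (P ᵈ) v u y

-- D(v) ⊊ D(u): every predecessor of v precedes u, and (v , u) has a left peeker.
PredecessorsGrow : ∀ {n} → FinPoset n → Fin n → Fin n → Set
PredecessorsGrow P v u = (∀ {a} → a ≺[ P ] v → a ≺[ P ] u) × Σ (Fin _) (LeftPeeker P v u)

-- u is nested in v: D(v) ⊊ D(u) and U(v) ⊊ U(u).  This is what I(u) ⊊ I(v) means for the
-- canonical representation; the notion is self-dual.
Nested : ∀ {n} → FinPoset n → Fin n → Fin n → Set
Nested P u v = PredecessorsGrow P v u × PredecessorsGrow (P ᵈ) v u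

nested-dual : ∀ {n} {P : FinPoset n} {u v} → Nested P u v → Nested (P ᵈ) u v
nested-dual = swap

nested-incomparable : ∀ {n} {P : FinPoset n} {u v} → Nested P u v → u ∥[ P ] v
nested-incomparable {P = P} {u} ((inherits-preds , _) , (inherits-succs , _)) =
  (λ u≺v → irrefl P u (inherits-preds u≺v)) , (λ v≺u → irrefl P u (inherits-succs v≺u))

-- Without 4+1 and Y a nested pair has at most one right peeker: two comparable right
-- peekers would extend a left peeker a ≺ u to a 4-chain, two incomparable ones would
-- form a Y over a ≺ u; in both cases v is incomparable to everything.
right-peeker-unique : ∀ {n} {P : FinPoset n} → FourPlusOneFree P → YFree P →
  ∀ {u v y y′} → Nested P u v → RightPeeker P v u y → RightPeeker P v u y′ → y ≡ y′
right-peeker-unique {P = P} no41 noY {u} {v} {y} {y′}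
  N@((_ , a , a≺u , a⊀v) , _) y-peeks@(u≺y , _) y′-peeks@(u≺y′ , _) =
  by-cases (T? (rel P y y′)) (T? (rel P y′ y)) (y ≟ᶠ y′)
  where
  u⊀v : ¬ u ≺[ P ] v
  u⊀v = proj₁ (nested-incomparable {P = P} N)
  v⊀u : ¬ v ≺[ P ] u
  v⊀u = proj₂ (nested-incomparable {P = P} N)
  v∥u : v ∥[ P ] u
  v∥u = v⊀u , u⊀v
  v∥a : v ∥[ P ] a
  v∥a = (λ v≺a → v⊀u (trans P v a u v≺a a≺u)) , a⊀v
  v∥_ : ∀ {z} → RightPeeker P v u z → v ∥[ P ] z
  v∥ (u≺z , v⊀z) = v⊀z , λ z≺v → u⊀v (trans P u _ v u≺z z≺v)
  by-cases : Dec (y ≺[ P ] y′) → Dec (y′ ≺[ P ] y) → Dec (y ≡ y′) → y ≡ y′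
  by-cases (yes y≺y′) _          _          =
    ⊥-elim (no41 a≺u u≺y y≺y′ v∥a v∥u (v∥ y-peeks) (v∥ y′-peeks))
  by-cases (no _)     (yes y′≺y) _          =
    ⊥-elim (no41 a≺u u≺y′ y′≺y v∥a v∥u (v∥ y′-peeks) (v∥ y-peeks))
  by-cases (no _)     (no _)     (yes y≡y′) = y≡y′
  by-cases (no y⊀y′)  (no y′⊀y)  (no y≢y′)  =
    ⊥-elim (noY a≺u u≺y u≺y′ (y⊀y′ , y′⊀y) y≢y′ v∥a (v∥ y-peeks) (v∥ y′-peeks) v∥u)

left-peeker-unique : ∀ {n} {P : FinPoset n} → FourPlusOneFree P → YFree (P ᵈ) →
  ∀ {u v x x′} → Nested P u v → LeftPeeker P v u x → LeftPeeker P v u x′ → x ≡ x′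
left-peeker-unique {P = P} no41 noYᵈ N =
  right-peeker-unique {P = P ᵈ} (fourPlusOneFree-dual {P = P} no41) noYᵈ (nested-dual {P = P} N)

-- A predecessor a of u₂ that
-- is neither below w nor below u₁ would be a second left peeker of (w , u₂), besides the left
-- peeker a₁ of (w , u₁), which crossing-freeness places below u₂.
common-outer-preds : ∀ {n} {P : FinPoset n} → Admissible P → ∀ {u₁ u₂ w a} →
  Nested P u₁ w → Nested P u₂ w → a ≺[ P ] u₂ → a ≺[ P ] u₁
common-outer-preds {P = P} A {u₁} {u₂} {w} {a}
  ((w-preds⇒u₁ , a₁ , a₁≺u₁ , a₁⊀w) , _) N₂ a≺u₂
  with T? (rel P a w) | crossingFree A a₁≺u₁ a≺u₂
... | yes a≺w | _          = w-preds⇒u₁ a≺w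
... | no _    | inj₂ a≺u₁  = a≺u₁
... | no a⊀w  | inj₁ a₁≺u₂ = subst (λ z → z ≺[ P ] u₁) a₁≡a a₁≺u₁
  where
  a₁≡a : a₁ ≡ a
  a₁≡a = left-peeker-unique {P = P} (fourPlusOneFree A) (yDualFree A) N₂
           (a₁≺u₂ , a₁⊀w) (a≺u₂ , a⊀w)

common-outer-twins : ∀ {n} {P : FinPoset n} → Admissible P → ∀ {u₁ u₂ w} →
  Nested P u₁ w → Nested P u₂ w → Twins P u₁ u₂
common-outer-twins {P = P} A N₁ N₂ z =
  mk⇔ (common-outer-preds A N₂ N₁) (common-outer-preds A N₁ N₂) ,
  mk⇔ (common-outer-preds Aᵈ (nested-dual {P = P} N₂) (nested-dual {P = P} N₁))
      (common-outer-preds Aᵈ (nested-dual {P = P} N₁) (nested-dual {P = P} N₂))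
  where
  Aᵈ : Admissible (P ᵈ)
  Aᵈ = admissible-dual A

-- If u is nested in both v and w, every predecessor a of w precedes v.  Otherwise a and the
-- left peeker b of (w , u) are both left peekers of (v , u), hence equal, but b ⊀ w.
common-inner-preds : ∀ {n} {P : FinPoset n} → Admissible P → ∀ {u v w a} →
  Nested P u v → Nested P u w → a ≺[ P ] w → a ≺[ P ] v
common-inner-preds {P = P} A {u} {v} {w} {a} Nv ((w-preds⇒u , b , b≺u , b⊀w) , _) a≺w
  with T? (rel P a v) | T? (rel P b v)
... | yes a≺v | _       = a≺v
... | no a⊀v  | yes b≺v = ⊥-elim ([ a⊀v , b⊀w ] (crossingFree A a≺w b≺v))
... | no a⊀v  | no b⊀v  = ⊥-elim (b⊀w (subst (λ z → z ≺[ P ] w) (sym b≡a) a≺w))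
  where
  b≡a : b ≡ a
  b≡a = left-peeker-unique {P = P} (fourPlusOneFree A) (yDualFree A) Nv
          (b≺u , b⊀v) (w-preds⇒u a≺w , a⊀v)

common-inner-twins : ∀ {n} {P : FinPoset n} → Admissible P → ∀ {u v w} →
  Nested P u v → Nested P u w → Twins P v w
common-inner-twins {P = P} A Nv Nw z =
  mk⇔ (common-inner-preds A Nw Nv) (common-inner-preds A Nv Nw) ,
  mk⇔ (common-inner-preds Aᵈ (nested-dual {P = P} Nw) (nested-dual {P = P} Nv))
      (common-inner-preds Aᵈ (nested-dual {P = P} Nv) (nested-dual {P = P} Nw))
  where
  Aᵈ : Admissible (P ᵈ)
  Aᵈ = admissible-dual A

module _ {n} {P : FinPoset n} (I : IntervalRep P) where

  meets⇒∥ : ∀ {x y} → Meets I x y → x ∥[ P ] y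
  meets⇒∥ {x} {y} (Lx≤Ry , Ly≤Rx) =
    (λ x≺y → <⇒≱ (to (repr I x y) x≺y) Ly≤Rx) , (λ y≺x → <⇒≱ (to (repr I y x) y≺x) Lx≤Ry)

  ∥⇒meets : ∀ {x y} → x ∥[ P ] y → Meets I x y
  ∥⇒meets {x} {y} (x⊀y , y⊀x) =
    ≮⇒≥ (λ Ry<Lx → y⊀x (from (repr I y x) Ry<Lx)) , ≮⇒≥ (λ Rx<Ly → x⊀y (from (repr I x y) Rx<Ly))

  peeksLeft⇒leftPeeker : ∀ {x v u} → PeeksLeft I x v u → LeftPeeker P v u x
  peeksLeft⇒leftPeeker {x} {v} {u} ((x-meets-v , ¬x-meets-u) , Rx≤Lu) =
    from (repr I x u) (≰⇒> λ Lu≤Rx → ¬x-meets-u (Lx≤Ru , Lu≤Rx)) , proj₁ (meets⇒∥ x-meets-v)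
    where
    Lx≤Ru : L I x ≤ R I u
    Lx≤Ru = ≤-trans (L≤R I x) (≤-trans Rx≤Lu (L≤R I u))

  -- ... and conversely, provided v ⊀ u (so that a left peeker cannot lie above v).
  leftPeeker⇒peeksLeft : ∀ {x v u} → ¬ v ≺[ P ] u → LeftPeeker P v u x → PeeksLeft I x v u
  leftPeeker⇒peeksLeft {x} {v} {u} v⊀u (x≺u , x⊀v) =
    (∥⇒meets (x⊀v , λ v≺x → v⊀u (trans P v x u v≺x x≺u)) ,
     (λ x-meets-u → proj₁ (meets⇒∥ x-meets-u) x≺u)) ,
    <⇒≤ (to (repr I x u) x≺u)

  peeksRight⇒rightPeeker : ∀ {y v u} → PeeksRight I y v u → RightPeeker P v u y
  peeksRight⇒rightPeeker {y} {v} {u} ((y-meets-v , ¬y-meets-u) , Ru≤Ly) =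
    from (repr I u y) (≰⇒> λ Ly≤Ru → ¬y-meets-u (Ly≤Ru , Lu≤Ry)) , proj₂ (meets⇒∥ y-meets-v)
    where
    Lu≤Ry : L I u ≤ R I y
    Lu≤Ry = ≤-trans (L≤R I u) (≤-trans Ru≤Ly (L≤R I y))

  rightPeeker⇒peeksRight : ∀ {y v u} → ¬ u ≺[ P ] v → RightPeeker P v u y → PeeksRight I y v u
  rightPeeker⇒peeksRight {y} {v} {u} u⊀v (u≺y , v⊀y) =
    (∥⇒meets ((λ y≺v → u⊀v (trans P u y v u≺y y≺v)) , v⊀y) ,
     (λ y-meets-u → proj₂ (meets⇒∥ y-meets-u) u≺y)) ,
    <⇒≤ (to (repr I u y) u≺y)

  unique-left-peeker : Admissible P → ∀ {u v} → Nested P u v → ∃! (λ x → PeeksLeft I x v u)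
  unique-left-peeker A N@((_ , a , a-peeks) , _) =
    a , leftPeeker⇒peeksLeft (proj₂ (nested-incomparable {P = P} N)) a-peeks ,
    λ x x-peeks → left-peeker-unique {P = P} (fourPlusOneFree A) (yDualFree A) N
                    (peeksLeft⇒leftPeeker x-peeks) a-peeks

  unique-right-peeker : Admissible P → ∀ {u v} → Nested P u v → ∃! (λ y → PeeksRight I y v u)
  unique-right-peeker A N@(_ , (_ , b , b-peeks)) =
    b , rightPeeker⇒peeksRight (proj₁ (nested-incomparable {P = P} N)) b-peeks ,
    λ y y-peeks → right-peeker-unique {P = P} (fourPlusOneFree A) (yFree A) N
                    (peeksRight⇒rightPeeker y-peeks) b-peeks

#↓ #↑ : ∀ {n} → FinPoset n → Fin n → ℕ
#↓ P x = # (λ a → rel P a x)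
#↑ P x = #↓ (P ᵈ) x

-- In a crossing-free order predecessor sets form a chain, so comparing their sizes compares
-- the sets: if a ≺ x but a ⊀ y, then D(y) ⊊ D(x).
preds-sub : ∀ {n} {P : FinPoset n} → CrossingFree P →
  ∀ {x y a} → #↓ P x ≤ #↓ P y → a ≺[ P ] x → a ≺[ P ] y
preds-sub {P = P} crossingFree {x} {y} {a} #x≤#y a≺x with T? (rel P a y)
... | yes a≺y = a≺y
... | no a⊀y  = ⊥-elim (<⇒≱ (#-strict D[y]⊆D[x] a a≺x a⊀y) #x≤#y)
  where
  D[y]⊆D[x] : ∀ b → b ≺[ P ] y → b ≺[ P ] x
  D[y]⊆D[x] b b≺y = [ (λ a≺y → ⊥-elim (a⊀y a≺y)) , (λ b≺x → b≺x) ] (crossingFree a≺x b≺y)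

succs-sub : ∀ {n} {P : FinPoset n} → CrossingFree P →
  ∀ {x y b} → #↑ P x ≤ #↑ P y → x ≺[ P ] b → y ≺[ P ] b
succs-sub {P = P} crossingFree = preds-sub {P = P ᵈ} (crossingFree-dual {P = P} crossingFree)

nested-from-counts : ∀ {n} {P : FinPoset n} → CrossingFree P →
  ∀ {u v} → #↓ P v < #↓ P u → #↑ P v < #↑ P u → Nested P u v
nested-from-counts {P = P} crossingFree #↓v<#↓u #↑v<#↑u =
  (preds-sub {P = P} crossingFree (<⇒≤ #↓v<#↓u) , #-witness #↓v<#↓u) ,
  (succs-sub {P = P} crossingFree (<⇒≤ #↑v<#↑u) , #-witness #↑v<#↑u)

-- Left digits are odd and right digits even, so a right end never equals a left end and
-- "R(x) < L(y)" reduces to a comparison of counts.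
even odd : ℕ → ℕ
even k = 2 * k
odd  k = suc (2 * k)

even<odd : ∀ {s d} → s ≤ d → even s < odd d
even<odd s≤d = s≤s (*-monoʳ-≤ 2 s≤d)

odd<even : ∀ {d s} → d < s → odd d < even s
odd<even {d} {s} d<s = subst (_≤ 2 * s) (*-suc 2 d) (*-monoʳ-≤ 2 d<s)

even≤odd⇒≤ : ∀ {s d} → even s ≤ odd d → s ≤ d
even≤odd⇒≤ 2s≤2d+1 = ≮⇒≥ (λ d<s → <⇒≱ (odd<even d<s) 2s≤2d+1)

odd-cancel-< : ∀ {a b} → odd a < odd b → a < b
odd-cancel-< {a} {b} lt = *-cancelˡ-< 2 a b (≤-pred lt)

even-cancel-< : ∀ {a b} → even a < even b → a < b
even-cancel-< {a} {b} = *-cancelˡ-< 2 a b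

-- Pairs of digits below M, read lexicographically as single numbers.
module Lexicographic (M : ℕ) where

  ⟨_,_⟩ : ℕ → ℕ → ℕ
  ⟨ a , b ⟩ = a * M + b

  lex-< : ∀ {a b c d} → b < M → a < c → ⟨ a , b ⟩ < ⟨ c , d ⟩
  lex-< {a} {b} {c} {d} b<M a<c = begin-strict
    a * M + b  <⟨ +-monoʳ-< (a * M) b<M ⟩
    a * M + M  ≡⟨ +-comm (a * M) M ⟩
    suc a * M  ≤⟨ *-monoˡ-≤ M a<c ⟩
    c * M      ≤⟨ m≤m+n (c * M) d ⟩
    c * M + d  ∎
    where open ≤-Reasoning

  lex-≤⇒≤ : ∀ {a b c d} → d < M → ⟨ a , b ⟩ ≤ ⟨ c , d ⟩ → a ≤ c
  lex-≤⇒≤ d<M ab≤cd = ≮⇒≥ (λ c<a → <⇒≱ (lex-< d<M c<a) ab≤cd)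

  lex-≤-snd : ∀ {a b d} → ⟨ a , b ⟩ ≤ ⟨ a , d ⟩ → b ≤ d
  lex-≤-snd {a} = +-cancelˡ-≤ (a * M) _ _

  -- Intervals are encoded crosswise, [ ⟨ ℓ , r ⟩ , ⟨ r , ℓ ⟩ ].  Strict containment of
  -- encoded intervals forces strict inequality at both ends of the (ℓ , r) intervals.
  crossed-strict : ∀ {ℓ₁ r₁ ℓ₂ r₂} → ℓ₂ < M → r₁ < M →
    ⟨ ℓ₂ , r₂ ⟩ ≤ ⟨ ℓ₁ , r₁ ⟩ → ⟨ r₁ , ℓ₁ ⟩ ≤ ⟨ r₂ , ℓ₂ ⟩ →
    ¬ (⟨ ℓ₁ , r₁ ⟩ ≡ ⟨ ℓ₂ , r₂ ⟩ × ⟨ r₁ , ℓ₁ ⟩ ≡ ⟨ r₂ , ℓ₂ ⟩) → ℓ₂ < ℓ₁ × r₁ < r₂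
  crossed-strict {ℓ₁} {r₁} {ℓ₂} {r₂} ℓ₂<M r₁<M L≤ R≤ distinct =
    ≤∧≢⇒< ℓ₂≤ℓ₁ ℓ₂≢ℓ₁ , ≤∧≢⇒< r₁≤r₂ r₁≢r₂
    where
    ℓ₂≤ℓ₁ : ℓ₂ ≤ ℓ₁
    ℓ₂≤ℓ₁ = lex-≤⇒≤ r₁<M L≤
    r₁≤r₂ : r₁ ≤ r₂
    r₁≤r₂ = lex-≤⇒≤ ℓ₂<M R≤
    identical : ℓ₂ ≡ ℓ₁ → r₁ ≡ r₂ → ⊥
    identical ℓ₂≡ℓ₁ r₁≡r₂ =
      distinct (cong₂ ⟨_,_⟩ (sym ℓ₂≡ℓ₁) r₁≡r₂ , cong₂ ⟨_,_⟩ r₁≡r₂ (sym ℓ₂≡ℓ₁))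
    ℓ₂≢ℓ₁ : ℓ₂ ≢ ℓ₁
    ℓ₂≢ℓ₁ ℓ₂≡ℓ₁ = identical ℓ₂≡ℓ₁
      (≤-antisym r₁≤r₂ (lex-≤-snd {ℓ₁} (subst (λ ℓ → ⟨ ℓ , r₂ ⟩ ≤ ⟨ ℓ₁ , r₁ ⟩) ℓ₂≡ℓ₁ L≤)))
    r₁≢r₂ : r₁ ≢ r₂
    r₁≢r₂ r₁≡r₂ = identical
      (≤-antisym ℓ₂≤ℓ₁ (lex-≤-snd {r₂} (subst (λ r → ⟨ r , ℓ₁ ⟩ ≤ ⟨ r₂ , ℓ₂ ⟩) r₁≡r₂ R≤))) r₁≡r₂

module Canonical {n} {P : FinPoset n} (crossingFree : CrossingFree P) where

  -- S(x) = { a | U(x) ⊆ U(a) }, the elements ending no later than x (successor sets form a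
  -- chain, so inclusion is decided by their sizes).
  S : Fin n → Fin n → Bool
  S x a = #↑ P x ≤ᵇ #↑ P a

  #S : Fin n → ℕ
  #S x = # (S x)

  -- x ≺ y means S(x) ⊆ D(y) ...
  #S≤#↓ : ∀ {x y} → x ≺[ P ] y → #S x ≤ #↓ P y
  #S≤#↓ {x} {y} x≺y = #-mono {p = S x} {q = λ a → rel P a y} λ a #↑x≤#↑a →
    succs-sub {P = P} crossingFree (≤ᵇ⇒≤ _ _ #↑x≤#↑a) x≺y

  -- ... while x ⊀ y means D(y) ⊊ S(x), with x itself in the difference.
  #↓<#S : ∀ {x y} → ¬ x ≺[ P ] y → #↓ P y < #S x
  #↓<#S {x} {y} x⊀y =
    #-strict {p = λ a → rel P a y} {q = S x} D[y]⊆S[x] x (≤⇒≤ᵇ (≤-refl {#↑ P x})) x⊀y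
    where
    D[y]⊆S[x] : ∀ a → a ≺[ P ] y → T (S x a)
    D[y]⊆S[x] a a≺y = ≤⇒≤ᵇ (#-mono {p = rel P x} {q = rel P a} λ b x≺b →
      [ (λ a≺b → a≺b) , (λ x≺y → ⊥-elim (x⊀y x≺y)) ] (crossingFree a≺y x≺b))

  #S≤#↓⇒≺ : ∀ {x y} → #S x ≤ #↓ P y → x ≺[ P ] y
  #S≤#↓⇒≺ {x} {y} #Sx≤#↓y =
    decidable-stable (T? (rel P x y)) λ x⊀y → <⇒≱ (#↓<#S x⊀y) #Sx≤#↓y

  #S-antitone : ∀ {u v} → #S u < #S v → #↑ P v < #↑ P u
  #S-antitone {u} {v} #Su<#Sv = ≰⇒> λ #↑u≤#↑v → <⇒≱ #Su<#Sv
    (#-mono {p = S v} {q = S u} λ a #↑v≤#↑a → ≤⇒≤ᵇ (≤-trans #↑u≤#↑v (≤ᵇ⇒≤ _ _ #↑v≤#↑a)))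

  M : ℕ
  M = suc (odd n)

  open Lexicographic M

  ℓ r : Fin n → ℕ
  ℓ x = odd (#↓ P x)
  r x = even (#S x)

  ℓ<M : ∀ {x} → ℓ x < M
  ℓ<M {x} = s≤s (s≤s (*-monoʳ-≤ 2 (#-bound (λ a → rel P a x))))

  r<M : ∀ {x} → r x < M
  r<M {x} = s≤s (m≤n⇒m≤1+n (*-monoʳ-≤ 2 (#-bound (S x))))

  canonical : IntervalRep P
  canonical = record
    { L    = λ x → ⟨ ℓ x , r x ⟩
    ; R    = λ x → ⟨ r x , ℓ x ⟩
    ; L≤R  = λ x → <⇒≤ (lex-< r<M (odd<even (#↓<#S (irrefl P x))))
    ; repr = λ x y → mk⇔ (λ x≺y → lex-< ℓ<M (even<odd (#S≤#↓ x≺y)))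
                         (λ Rx<Ly → #S≤#↓⇒≺ (even≤odd⇒≤ (lex-≤⇒≤ r<M (<⇒≤ Rx<Ly))))
    }

  strict⇒nested : ∀ {u v} → StrictlyContained canonical u v → Nested P u v
  strict⇒nested ((Lv≤Lu , Ru≤Rv) , distinct) with crossed-strict ℓ<M r<M Lv≤Lu Ru≤Rv distinct
  ... | ℓv<ℓu , ru<rv =
    nested-from-counts {P = P} crossingFree (odd-cancel-< ℓv<ℓu) (#S-antitone (even-cancel-< ru<rv))

proposition13 : ∀ {n} (P : FinPoset n) → IsIntervalOrder P → TwinFree P → Forbidden P →
    Σ (IntervalRep P) λ I →
      (∀ u v w → u ≢ v → ¬ (StrictlyContained I u w × StrictlyContained I v w))
      × (∀ u v w → v ≢ w → ¬ (StrictlyContained I u v × StrictlyContained I u w))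
      × (∀ u v → StrictlyContained I u v →
           ∃! (λ x → PeeksLeft I x v u) × ∃! (λ y → PeeksRight I y v u))
proposition13 P I₀ twinFree forbidden =
  canonical ,
  (λ u v w u≢v (u⊂w , v⊂w) →
     u≢v (twinFree u v (common-outer-twins A (strict⇒nested u⊂w) (strict⇒nested v⊂w)))) ,
  (λ u v w v≢w (u⊂v , u⊂w) →
     v≢w (twinFree v w (common-inner-twins A (strict⇒nested u⊂v) (strict⇒nested u⊂w)))) ,
  (λ u v u⊂v → unique-left-peeker canonical A (strict⇒nested u⊂v) ,
               unique-right-peeker canonical A (strict⇒nested u⊂v))
  where
  A : Admissible P
  A = admissible I₀ forbidden
  open Canonical (crossingFree A)
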